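{- If $p$ is an odd prime then $$P_{2p}(s,t)=\sum_{k\ge0}\left[\binom{p-k}{k}+\binom{p-k-1}{k-1}\right]s^{p-2k-1}t^k,$$ and $$s\,P_{2p}(s,t)=\{p+1\}+t\{p-1\}.$$
   Context: Let $s,t$ be variables; the Lucas polynomials are $\{0\}=0$, $\{1\}=1$, $\{n\}=s\{n-1\}+t\{n-2\}$ for $n\ge2$. Binomial coefficients $\binom ab$ are $0$ if $b<0$ or $b>a$. Let $\Phi_n(q)$ be the $n$th cyclotomic polynomial and $\phi$ the Euler totient function; for $n\ge 2$ write uniquely $\Phi_n(q)=\sum_{0\le j\le\phi(n)/2}\gamma_j q^j(1+q)^{\phi(n)-2j}$ with $\gamma_j\in\mathbb{C}$ (possible since $\Phi_n$ is palindromic of degree $\phi(n)$ with constant term 1); the Lucas atom is $P_n(s,t)=\sum_j\gamma_j s^{\phi(n)-2j}(-t)^j$. -}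

module Defs where

open import Level using (Level)
open import Data.Nat as ℕ using (ℕ; zero; suc; _∸_; _≟_)
open import Data.Nat.Divisibility using (_∣?_)
open import Data.Nat.GCD using (gcd)
open import Data.Nat.Combinatorics using (_C_)
open import Data.List using (List; []; _∷_; filter; foldr; length; upTo; map)
open import Algebra.Bundles using (CommutativeRing)
open import Relation.Nullary.Decidable using (does)
open import Data.Bool using (if_then_else_)

φ : ℕ → ℕ
φ n = length (filter (λ k → gcd k n ≟ 1) (map suc (upTo n)))

divisors : ℕ → List ℕ
divisors n = filter (λ d → d ∣? n) (map suc (upTo n))

module WithRing {c ℓ : Level} (R : CommutativeRing c ℓ) where
  open CommutativeRing R

  natR : ℕ → Carrier
  natR zero    = 0#
  natR (suc n) = 1# + natR n

  pow : Carrier → ℕ → Carrier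
  pow x zero    = 1#
  pow x (suc n) = x * pow x n

  sumBelow : ℕ → (ℕ → Carrier) → Carrier
  sumBelow zero    f = 0#
  sumBelow (suc n) f = sumBelow n f + f n

  sumUpTo : ℕ → (ℕ → Carrier) → Carrier
  sumUpTo n f = sumBelow (suc n) f

  -- Lucas polynomials {n} evaluated at s, t
  lucas : ℕ → Carrier → Carrier → Carrier
  lucas zero          s t = 0#
  lucas (suc zero)    s t = 1#
  lucas (suc (suc n)) s t = s * lucas (suc n) s t + t * lucas n s t

  -- Polynomials / formal power series in one variable q over R,
  -- represented by their coefficient sequences.
  Ser : Set c
  Ser = ℕ → Carrier

  _≋_ : Ser → Ser → Set ℓ
  f ≋ g = ∀ i → f i ≈ g i

  _⊕_ : Ser → Ser → Ser
  (f ⊕ g) i = f i + g i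

  ⊖_ : Ser → Ser
  (⊖ f) i = - f i

  _⊛_ : Ser → Ser → Ser
  (f ⊛ g) i = sumUpTo i (λ k → f k * g (i ∸ k))

  const : Carrier → Ser
  const a zero    = a
  const a (suc i) = 0#

  oneS : Ser
  oneS = const 1#

  qS : Ser
  qS zero          = 0#
  qS (suc zero)    = 1#
  qS (suc (suc i)) = 0#

  powS : Ser → ℕ → Ser
  powS f zero    = oneS
  powS f (suc n) = f ⊛ powS f n

  scaleS : Carrier → Ser → Ser
  (scaleS a f) i = a * f i

  prodS : List ℕ → (ℕ → Ser) → Ser
  prodS ds F = foldr (λ d acc → F d ⊛ acc) oneS ds

  -- Φ is the family of cyclotomic polynomials: for all n ≥ 1,
  -- ∏_{d ∣ n} Φ_d(q) = q^n - 1.  (This determines Φ uniquely.)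
  IsCyclotomic : (ℕ → Ser) → Set ℓ
  IsCyclotomic Φ = ∀ n → prodS (divisors (suc n)) Φ ≋ (powS qS (suc n) ⊕ (⊖ oneS))

  IsAtomExpansion : ℕ → Ser → (ℕ → Carrier) → Set ℓ
  IsAtomExpansion m f γ =
    ∀ i → f i ≈ sumUpTo (m ℕ./ 2)
                  (λ j → γ j * (powS qS j ⊛ powS (oneS ⊕ qS) (m ∸ 2 ℕ.* j)) i)

  lucasAtom : ℕ → (ℕ → Carrier) → Carrier → Carrier → Carrier
  lucasAtom n γ s t =
    sumUpTo (φ n ℕ./ 2) (λ j → γ j * (pow s (φ n ∸ 2 ℕ.* j) * pow (- t) j))

  -- Σ_{k ≥ 0} [C(p-k,k) + C(p-k-1,k-1)] s^(p-2k-1) t^k ; terms with k > p/2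
  -- vanish (both binomials are 0), so the sum is over 0 ≤ k ≤ ⌊p/2⌋.
  binom2 : ℕ → ℕ → ℕ
  binom2 p zero    = (p C 0)
  binom2 p (suc k) = ((p ∸ suc k) C suc k) ℕ.+ ((p ∸ suc k ∸ 1) C k)

  rhsSum : ℕ → Carrier → Carrier → Carrier
  rhsSum p s t =
    sumUpTo (p ℕ./ 2) (λ k → natR (binom2 p k) * (pow s (p ∸ (2 ℕ.* k) ∸ 1) * pow t k))

module Submission where

-- Write p = 2h + 1, so that φ(2p) = 2h. From ∏_{d ∣ n} Φ_d = q^n - 1 for n = 1, 2, p, 2p one gets
-- (1 + q) Φ_2p ≡ 1 (mod q^p). Multiplying the expansion Φ_2p = Σ_j γ_j q^j (1 + q)^(2h-2j) by 1 + q
-- therefore gives Σ_j γ_j q^j (1 + q)^(p-2j) ≡ 1 (mod q^p); as the family q^j (1 + q)^(p-2j), j ≤ h, is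
-- triangular, this congruence determines γ. The companion Lucas polynomial V_p(x, y) = Σ_j v_(p,j) x^(p-2j) y^j
-- (V_0 = 2, V_1 = x, V_n = x V_(n-1) + y V_(n-2)) takes the value 1 + q^p at x = 1 + q, y = -q, whence
-- γ_j = (-1)^j v_(p,j). So P_2p(s, t) = Σ_j v_(p,j) s^(p-1-2j) t^j, hence s P_2p(s, t) = V_p(s, t), which is
-- {p+1} + t {p-1}; and v_(p,j) = C(p-j, j) + C(p-j-1, j-1) gives the first formula.

open import Defs
open import Level using (Level; 0ℓ)
open import Algebra.Bundles using (CommutativeRing)
open import Data.Nat as ℕ using (ℕ; zero; suc; _∸_; _≤_; _<_; z≤n; s≤s; _≟_)
open import Data.Nat.Primality using (Prime)
open import Data.Product using (_×_; _,_)
open import Data.Sum using (inj₁; inj₂)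
open import Relation.Binary.PropositionalEquality as ≡ using (_≡_)

module Arithmetic where
  open import Data.Nat using (_+_; _*_)
  open import Data.Nat.Base using (nonTrivial⇒≢1)
  open import Data.Nat.Divisibility using (_∣_; divides; _∣?_; ∣⇒≤; ∣-refl; ∣-trans)
  open import Data.Nat.DivMod using (_/_; m/n≡1+[m∸n]/n)
  open import Data.Nat.GCD using (gcd)
  open import Data.Nat.Coprimality as Coprime
    using (Coprime; coprime⇒gcd≡1; gcd≡1⇒coprime; coprime-divisor; prime⇒coprime)
  open import Data.Nat.Primality using (prime⇒irreducible; prime⇒nonTrivial)
  open import Data.Nat.Tactic.RingSolver using (solve-∀)
  open import Data.List using (List; []; _∷_; [_]; _++_; filter; length; map; upTo; applyUpTo)
  open import Data.List.Properties
    using (filter-++; filter-accept; filter-reject; map-applyUpTo; applyUpTo-∷ʳ; length-++; ++-identityʳ)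
  open import Data.Product using (∃-syntax)
  open import Data.Sum using (_⊎_)
  open import Data.Empty using (⊥-elim)
  open import Function using (_⟨_⟩_)
  open import Relation.Nullary using (¬_)
  open import Relation.Unary using (Pred; Decidable)
  open import Data.Nat.Properties
    using ( +-suc; +-comm; +-identityʳ; *-identityʳ; *-zeroʳ; *-comm; *-suc; ∸-+-assoc; suc-injective
          ; ≤-refl; ≤-trans; ≤-pred; n≤1+n; m≤n⇒m≤1+n; m≤m+n; +-monoʳ-≤; +-mono-≤
          ; n<1+n; m<n⇒m<1+n; <-trans; m<m+n; +-monoʳ-<; +-mono-<; <⇒≱; <⇒≢; <-irrefl)
  open ≡ using (_≢_; refl; sym; trans; cong; cong₂; subst; subst₂; ≢-sym; module ≡-Reasoning)

  odd-shape : ∀ n → ¬ 2 ∣ n → ∃[ h ] n ≡ suc (h + h)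
  odd-shape 0 odd = ⊥-elim (odd (divides 0 refl))
  odd-shape 1 _ = 0 , refl
  odd-shape (suc (suc n)) odd with odd-shape n (λ { (divides q e) → odd (divides (suc q) (cong (2 +_) e)) })
  ... | h , refl = suc h , cong (2 +_) (sym (+-suc h h))

  odd-prime-shape : ∀ {p} → Prime p → ¬ 2 ∣ p → ∃[ m ] p ≡ suc (suc m + suc m)
  odd-prime-shape p-prime odd with odd-shape _ odd
  ... | 0 , refl = ⊥-elim (nonTrivial⇒≢1 {{prime⇒nonTrivial p-prime}} refl)
  ... | suc m , refl = m , refl

  module FilterUpTo {P : Pred ℕ 0ℓ} (P? : Decidable P) where

    selected : ℕ → List ℕ
    selected k = filter P? (applyUpTo suc k)

    selected-upTo : ∀ n → filter P? (map suc (upTo n)) ≡ selected n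
    selected-upTo n = cong (filter P?) (map-applyUpTo (λ x → x) suc n)

    selected-suc : ∀ k → selected (suc k) ≡ selected k ++ filter P? [ suc k ]
    selected-suc k = trans (cong (filter P?) (sym (applyUpTo-∷ʳ suc k))) (filter-++ P? (applyUpTo suc k) [ suc k ])

    selected-accept : ∀ {k} → P (suc k) → selected (suc k) ≡ selected k ++ [ suc k ]
    selected-accept {k} Pk = trans (selected-suc k) (cong (selected k ++_) (filter-accept P? Pk))

    selected-reject : ∀ {k} → ¬ P (suc k) → selected (suc k) ≡ selected k
    selected-reject {k} ¬Pk =
      trans (selected-suc k) (trans (cong (selected k ++_) (filter-reject P? ¬Pk)) (++-identityʳ (selected k)))

    selected-gap : ∀ a j → (∀ i → i < j → ¬ P (suc (a + i))) → selected (a + j) ≡ selected a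
    selected-gap a zero _ = cong selected (+-identityʳ a)
    selected-gap a (suc j) gap = trans (cong selected (+-suc a j))
      (trans (selected-reject (gap j (n<1+n j))) (selected-gap a j (λ i i<j → gap i (m<n⇒m<1+n i<j))))

    count-accept : ∀ {k} → P (suc k) → length (selected (suc k)) ≡ suc (length (selected k))
    count-accept {k} Pk =
      trans (cong length (selected-accept Pk)) (trans (length-++ (selected k)) (+-comm (length (selected k)) 1))

    count-reject : ∀ {k} → ¬ P (suc k) → length (selected (suc k)) ≡ length (selected k)
    count-reject ¬Pk = cong length (selected-reject ¬Pk)

  1∣_ : ∀ n → 1 ∣ n
  1∣ n = divides n (sym (*-identityʳ n))

  divisor-cases : ∀ {d n} → d ∣ n → n ≡ 0 ⊎ n ≡ d ⊎ d + d ≤ n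
  divisor-cases (divides 0 e) = inj₁ e
  divisor-cases {d} (divides 1 e) = inj₂ (inj₁ (trans e (+-identityʳ d)))
  divisor-cases {d} (divides (suc (suc q)) refl) = inj₂ (inj₂ (+-monoʳ-≤ d (m≤m+n d (q * d))))

  2∤odd : ∀ i → ¬ 2 ∣ suc (i + i)
  2∤odd i (divides q e) = odd≢even i q e
    where
    odd≢even : ∀ i q → suc (i + i) ≢ q * 2
    odd≢even 0 0 ()
    odd≢even (suc i) (suc q) e = odd≢even i q (trans (sym (+-suc i i)) (suc-injective (suc-injective e)))

  suc[m]∸n∸1≡m∸n : ∀ m n → suc m ∸ n ∸ 1 ≡ m ∸ n
  suc[m]∸n∸1≡m∸n m n = trans (∸-+-assoc (suc m) n 1) (cong (suc m ∸_) (+-comm n 1))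

  double/2 : ∀ k → (k + k) / 2 ≡ k
  double/2 zero = refl
  double/2 (suc k) =
    cong (_/ 2) (cong suc (+-suc k k)) ⟨ trans ⟩ m/n≡1+[m∸n]/n {2 + (k + k)} {2} (s≤s (s≤s z≤n)) ⟨ trans ⟩ cong suc (double/2 k)

  suc-double/2 : ∀ k → suc (k + k) / 2 ≡ k
  suc-double/2 zero = refl
  suc-double/2 (suc k) =
    cong (_/ 2) (cong (2 +_) (+-suc k k)) ⟨ trans ⟩ m/n≡1+[m∸n]/n {3 + (k + k)} {2} (s≤s (s≤s z≤n)) ⟨ trans ⟩ cong suc (suc-double/2 k)

  module OddPrime (m : ℕ) (p-prime : Prime (suc (suc m + suc m))) where

    h p N : ℕ
    h = suc m
    p = suc (h + h)
    N = 2 * p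

    N≡p+p : N ≡ p + p
    N≡p+p = cong (p +_) (+-identityʳ p)

    p∣N : p ∣ N
    p∣N = divides 2 refl

    2∣N : 2 ∣ N
    2∣N = divides p (*-comm 2 p)

    p<N : p < N
    p<N = subst (p <_) (sym N≡p+p) (m<m+n p (s≤s z≤n))

    ∤p : ∀ d → 2 ≤ d → d < p → ¬ d ∣ p
    ∤p d 2≤d d<p d∣p with prime⇒irreducible p-prime d∣p
    ... | inj₁ refl = <⇒≱ 2≤d ≤-refl
    ... | inj₂ refl = <-irrefl refl d<p

    ∤N-below-p : ∀ d → 3 ≤ d → d < p → ¬ d ∣ N
    ∤N-below-p d@(suc d-1) 3≤d d<p d∣N = <⇒≱ 3≤d (∣⇒≤ d∣2)
      where
      d∣2 : d ∣ 2
      d∣2 = coprime-divisor (Coprime.sym (prime⇒coprime p-prime d<p)) (subst (d ∣_) (*-comm 2 p) d∣N)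

    ∤N-above-p : ∀ d → p < d → d < N → ¬ d ∣ N
    ∤N-above-p d p<d d<N d∣N with divisor-cases d∣N
    ... | inj₁ ()
    ... | inj₂ (inj₁ N≡d) = <-irrefl (sym N≡d) d<N
    ... | inj₂ (inj₂ d+d≤N) = <⇒≱ (+-mono-< p<d p<d) (subst (d + d ≤_) N≡p+p d+d≤N)

    module ByDivisibility (n : ℕ) = FilterUpTo (λ d → d ∣? n)

    divisors-p : divisors p ≡ 1 ∷ p ∷ []
    divisors-p = begin
      divisors p                                  ≡⟨ selected-upTo p ⟩
      selected (suc (1 + (m + suc m)))            ≡⟨ selected-accept ∣-refl ⟩
      selected (1 + (m + suc m)) ++ [ p ]         ≡⟨ cong (_++ [ p ]) (selected-gap 1 (m + suc m) gap) ⟩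
      selected 1 ++ [ p ]                         ≡⟨ cong (_++ [ p ]) (selected-accept {0} (1∣ p)) ⟩
      1 ∷ p ∷ []                                  ∎
      where
      open ByDivisibility p
      open ≡-Reasoning
      gap : ∀ i → i < m + suc m → ¬ 2 + i ∣ p
      gap i i<j = ∤p (2 + i) (s≤s (s≤s z≤n)) (s≤s (s≤s i<j))

    divisors-2p : divisors N ≡ 1 ∷ 2 ∷ p ∷ N ∷ []
    divisors-2p = begin
      divisors N                                        ≡⟨ selected-upTo N ⟩
      selected N                                        ≡⟨ cong selected N≡ ⟩
      selected (suc (p + (h + h)))                      ≡⟨ selected-accept (subst (_∣ N) N≡ ∣-refl) ⟩
      selected (p + (h + h)) ++ [ suc (p + (h + h)) ]   ≡⟨ cong₂ _++_ (selected-gap p (h + h) gap-above) (cong [_] (sym N≡)) ⟩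
      selected (suc (h + h)) ++ [ N ]                   ≡⟨ cong (_++ [ N ]) (selected-accept p∣N) ⟩
      (selected (h + h) ++ [ p ]) ++ [ N ]              ≡⟨ cong (λ k → (selected k ++ [ p ]) ++ [ N ]) h+h≡ ⟩
      (selected (2 + (m + m)) ++ [ p ]) ++ [ N ]        ≡⟨ cong (λ xs → (xs ++ [ p ]) ++ [ N ]) (selected-gap 2 (m + m) gap-below) ⟩
      (selected 2 ++ [ p ]) ++ [ N ]                    ≡⟨ cong (λ xs → (xs ++ [ p ]) ++ [ N ]) selected-2 ⟩
      1 ∷ 2 ∷ p ∷ N ∷ []                                ∎
      where
      open ByDivisibility N
      open ≡-Reasoning
      selected-2 : selected 2 ≡ 1 ∷ 2 ∷ []
      selected-2 = trans (selected-accept {1} 2∣N) (cong (_++ [ 2 ]) (selected-accept {0} (1∣ N)))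
      N≡ : N ≡ suc (p + (h + h))
      N≡ = trans N≡p+p (+-suc p (h + h))
      h+h≡ : h + h ≡ 2 + (m + m)
      h+h≡ = cong suc (+-suc m m)
      gap-above : ∀ i → i < h + h → ¬ suc (p + i) ∣ N
      gap-above i i<h+h = ∤N-above-p (suc (p + i)) (s≤s (m≤m+n p i)) (subst (suc (p + i) <_) (sym N≡) (s≤s (+-monoʳ-< p i<h+h)))
      gap-below : ∀ i → i < m + m → ¬ 3 + i ∣ N
      gap-below i i<m+m =
        ∤N-below-p (3 + i) (s≤s (s≤s (s≤s z≤n))) (subst (3 + i <_) (cong suc (sym h+h≡)) (s≤s (s≤s (s≤s i<m+m))))

    odd-coprime : ∀ i → suc (i + i) ≢ p → suc (i + i) < N → gcd (suc (i + i)) N ≡ 1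
    odd-coprime i d≢p d<N = coprime⇒gcd≡1 coprime-N
      where
      d = suc (i + i)
      coprime-p : Coprime d p
      coprime-p (e∣d , e∣p) with prime⇒irreducible p-prime e∣p
      ... | inj₁ e≡1 = e≡1
      ... | inj₂ refl with divisor-cases e∣d
      ...   | inj₁ ()
      ...   | inj₂ (inj₁ d≡p) = ⊥-elim (d≢p d≡p)
      ...   | inj₂ (inj₂ p+p≤d) = ⊥-elim (<⇒≱ d<N (subst (_≤ d) (sym N≡p+p) p+p≤d))
      coprime-N : Coprime d N
      coprime-N {e} (e∣d , e∣N) = divisor-of-2 e e∣d e∣2
        where
        e∣2 : e ∣ 2
        e∣2 = coprime-divisor (λ (g∣e , g∣p) → coprime-p (∣-trans g∣e e∣d , g∣p)) (subst (e ∣_) (*-comm 2 p) e∣N)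
        divisor-of-2 : ∀ e → e ∣ d → e ∣ 2 → e ≡ 1
        divisor-of-2 0 (divides q d≡q*0) _ with trans d≡q*0 (*-zeroʳ q)
        ... | ()
        divisor-of-2 1 _ _ = refl
        divisor-of-2 2 2∣d _ = ⊥-elim (2∤odd i 2∣d)
        divisor-of-2 (suc (suc (suc e))) _ e∣2 with ∣⇒≤ e∣2
        ... | s≤s (s≤s ())

    even-not-coprime : ∀ i → gcd (suc (suc (i + i))) N ≢ 1
    even-not-coprime i gcd≡1 with gcd≡1⇒coprime gcd≡1 (2∣even , 2∣N)
      where
      2∣even : 2 ∣ suc (suc (i + i))
      2∣even = divides (suc i) (cong (2 +_) (trans (cong (i +_) (sym (+-identityʳ i))) (*-comm 2 i)))
    ... | ()

    p-not-coprime : gcd p N ≢ 1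
    p-not-coprime gcd≡1 with gcd≡1⇒coprime gcd≡1 (∣-refl , p∣N)
    ... | ()

    module ByCoprimality = FilterUpTo (λ k → gcd k N ≟ 1)
    open ByCoprimality using (selected; count-accept; count-reject)

    coprimes : ℕ → ℕ
    coprimes k = length (selected k)

    coprimes₂ : ℕ → ℕ
    coprimes₂ i = coprimes (i + i)

    coprimes₂-suc : ∀ i → gcd (suc (i + i)) N ≡ 1 → coprimes₂ (suc i) ≡ suc (coprimes₂ i)
    coprimes₂-suc i coprime = begin
      coprimes (suc i + suc i)      ≡⟨ cong (λ k → coprimes (suc k)) (+-suc i i) ⟩
      coprimes (suc (suc (i + i)))  ≡⟨ count-reject (even-not-coprime i) ⟩
      coprimes (suc (i + i))        ≡⟨ count-accept coprime ⟩
      suc (coprimes₂ i)             ∎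
      where open ≡-Reasoning

    coprimes₂-suc-skip : ∀ i → gcd (suc (i + i)) N ≢ 1 → coprimes₂ (suc i) ≡ coprimes₂ i
    coprimes₂-suc-skip i not-coprime = begin
      coprimes (suc i + suc i)      ≡⟨ cong (λ k → coprimes (suc k)) (+-suc i i) ⟩
      coprimes (suc (suc (i + i)))  ≡⟨ count-reject (even-not-coprime i) ⟩
      coprimes (suc (i + i))        ≡⟨ count-reject not-coprime ⟩
      coprimes₂ i                   ∎
      where open ≡-Reasoning

    coprimes₂-below-p : ∀ i → i ≤ h → coprimes₂ i ≡ i
    coprimes₂-below-p zero _ = refl
    coprimes₂-below-p (suc i) (s≤s i≤m) =
      trans (coprimes₂-suc i (odd-coprime i (<⇒≢ odd<p) (<-trans odd<p p<N))) (cong suc (coprimes₂-below-p i (m≤n⇒m≤1+n i≤m)))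
      where
      odd<p : suc (i + i) < p
      odd<p = s≤s (s≤s (+-mono-≤ i≤m (m≤n⇒m≤1+n i≤m)))

    coprimes₂-beyond-p : ∀ j → j ≤ h → coprimes₂ (suc h + j) ≡ h + j
    coprimes₂-beyond-p zero _ =
      cong coprimes₂ (+-identityʳ (suc h)) ⟨ trans ⟩ coprimes₂-suc-skip h p-not-coprime ⟨ trans ⟩
      coprimes₂-below-p h ≤-refl ⟨ trans ⟩ sym (+-identityʳ h)
    coprimes₂-beyond-p (suc j) (s≤s j≤m) =
      cong coprimes₂ (+-suc (suc h) j) ⟨ trans ⟩ coprimes₂-suc i (odd-coprime i p≢odd odd<N) ⟨ trans ⟩
      cong suc (coprimes₂-beyond-p j (m≤n⇒m≤1+n j≤m)) ⟨ trans ⟩ sym (+-suc h j)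
      where
      i = suc h + j
      p≢odd : suc (i + i) ≢ p
      p≢odd = ≢-sym (<⇒≢ (s≤s (s≤s (+-mono-≤ (m≤m+n h j) (≤-trans (m≤m+n h j) (n≤1+n _))))))
      suc-i≤p : suc i ≤ p
      suc-i≤p = s≤s (subst (_≤ h + h) (+-suc h j) (+-monoʳ-≤ h (s≤s j≤m)))
      odd<N : suc (i + i) < N
      odd<N = subst₂ _≤_ (cong suc (+-suc i i)) (sym N≡p+p) (+-mono-≤ suc-i≤p suc-i≤p)

    φ-2p : φ N ≡ h + h
    φ-2p = cong length (ByCoprimality.selected-upTo N) ⟨ trans ⟩ cong coprimes N≡p+p ⟨ trans ⟩
           coprimes₂-beyond-p h ≤-refl

  -- vCoeff n j is v_(n,j), the coefficient of x^(n-2j) y^j in the companion Lucas polynomial V_n(x, y).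
  vCoeff : ℕ → ℕ → ℕ
  vCoeff 0 0 = 2
  vCoeff 0 (suc j) = 0
  vCoeff 1 0 = 1
  vCoeff 1 (suc j) = 0
  vCoeff (suc (suc n)) 0 = vCoeff (suc n) 0
  vCoeff (suc (suc n)) (suc j) = vCoeff (suc n) (suc j) + vCoeff n j

  vCoeff-suc-zero : ∀ n → vCoeff (suc n) 0 ≡ 1
  vCoeff-suc-zero zero = refl
  vCoeff-suc-zero (suc n) = vCoeff-suc-zero n

  vCoeff-vanish : ∀ n j → n < 2 * j → vCoeff n j ≡ 0
  vCoeff-vanish 0 (suc j) _ = refl
  vCoeff-vanish 1 (suc j) _ = refl
  vCoeff-vanish (suc (suc n)) (suc j) n+2<2j+2 =
    cong₂ _+_ (vCoeff-vanish (suc n) (suc j) (<-trans (n<1+n _) n+2<2j+2))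
              (vCoeff-vanish n j (≤-pred (≤-pred (subst (3 + n ≤_) (*-suc 2 j) n+2<2j+2))))

  [w+x]+[y+z]≡[x+z]+[w+y] : ∀ w x y z → (w + x) + (y + z) ≡ (x + z) + (w + y)
  [w+x]+[y+z]≡[x+z]+[w+y] = solve-∀

open Arithmetic

module RingArithmetic {c ℓ : Level} (R : CommutativeRing c ℓ) where
  open CommutativeRing R hiding (zero)
  open WithRing R using (natR)
  open import Algebra.Properties.Ring ring using (-‿distribˡ-*; -‿distribʳ-*; -‿involutive; -0#≈0#)
  open import Algebra.Properties.AbelianGroup +-abelianGroup using (⁻¹-∙-comm; ⁻¹-anti-homo‿-)
  open import Algebra.Properties.CommutativeSemigroup +-commutativeSemigroup using (interchange)
  open import Relation.Binary.Reasoning.Setoid setoid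

  natR-+ : ∀ m n → natR (m ℕ.+ n) ≈ natR m + natR n
  natR-+ zero n = sym (+-identityˡ _)
  natR-+ (suc m) n = trans (+-congˡ (natR-+ m n)) (sym (+-assoc _ _ _))

  natR-* : ∀ m n → natR (m ℕ.* n) ≈ natR m * natR n
  natR-* zero n = sym (zeroˡ _)
  natR-* (suc m) n = begin
    natR (n ℕ.+ m ℕ.* n)          ≈⟨ natR-+ n (m ℕ.* n) ⟩
    natR n + natR (m ℕ.* n)       ≈⟨ +-cong (sym (*-identityˡ _)) (natR-* m n) ⟩
    1# * natR n + natR m * natR n ≈⟨ sym (distribʳ _ _ _) ⟩
    (1# + natR m) * natR n        ∎

  -‿interchange : ∀ w x y z → (w + x) - (y + z) ≈ (w - y) + (x - z)
  -‿interchange w x y z = trans (+-congˡ (sym (⁻¹-∙-comm y z))) (interchange w x (- y) (- z))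

  -‿cancelʳ : ∀ x y z → (x + z) - (y + z) ≈ x - y
  -‿cancelʳ x y z = trans (-‿interchange x z y z) (trans (+-congˡ (-‿inverseʳ z)) (+-identityʳ _))

  -‿*-expand : ∀ a b c d → (a - b) * (c - d) ≈ (a * c + b * d) - (a * d + b * c)
  -‿*-expand a b c d = begin
    (a - b) * (c - d)                           ≈⟨ distribʳ _ _ _ ⟩
    a * (c - d) + - b * (c - d)                 ≈⟨ +-cong (distribˡ _ _ _) (distribˡ _ _ _) ⟩
    (a * c + a * - d) + (- b * c + - b * - d)   ≈⟨ +-cong (+-congˡ (sym (-‿distribʳ-* a d)))
                                                            (+-cong (sym (-‿distribˡ-* b c)) neg-neg) ⟩
    (a * c - a * d) + (- (b * c) + b * d)       ≈⟨ +-congˡ (+-comm _ _) ⟩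
    (a * c - a * d) + (b * d - b * c)           ≈⟨ sym (-‿interchange _ _ _ _) ⟩
    (a * c + b * d) - (a * d + b * c)           ∎
    where
    neg-neg : - b * - d ≈ b * d
    neg-neg = trans (sym (-‿distribˡ-* b (- d))) (trans (-‿cong (sym (-‿distribʳ-* b d))) (-‿involutive _))

  -- Integer coefficients are represented as coprimes₂ (a , b) standing for a − b; comparing them
  -- is decidable, which the ring solver needs to normalise polynomials.
  module Solver where
    open import Algebra.Bundles using (RawRing)
    open import Algebra.Solver.Ring.AlmostCommutativeRing
      using (fromCommutativeRing; _-Raw-AlmostCommutative⟶_)
    open import Data.Maybe using (Maybe; just; nothing)
    open import Relation.Nullary using (yes; no)

    ℤ-coprimes₂ : RawRing 0ℓ 0ℓ
    ℤ-coprimes₂ = record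
      { Carrier = ℕ × ℕ ; _≈_ = _≡_
      ; _+_ = λ { (a , b) (c , d) → (a ℕ.+ c , b ℕ.+ d) }
      ; _*_ = λ { (a , b) (c , d) → (a ℕ.* c ℕ.+ b ℕ.* d , a ℕ.* d ℕ.+ b ℕ.* c) }
      ; -_ = λ { (a , b) → (b , a) }
      ; 0# = (0 , 0) ; 1# = (1 , 0) }

    ⟦_⟧ℤ : ℕ × ℕ → Carrier
    ⟦ (a , b) ⟧ℤ = natR a - natR b

    ℤ-coprimes₂⟶R : ℤ-coprimes₂ -Raw-AlmostCommutative⟶ fromCommutativeRing R
    ℤ-coprimes₂⟶R = record
      { ⟦_⟧ = ⟦_⟧ℤ
      ; +-homo = λ { (a , b) (c , d) → trans (+-cong (natR-+ a c) (-‿cong (natR-+ b d))) (-‿interchange _ _ _ _) }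
      ; *-homo = λ { (a , b) (c , d) → trans (+-cong (trans (natR-+ (a ℕ.* c) (b ℕ.* d)) (+-cong (natR-* a c) (natR-* b d)))
                                                     (-‿cong (trans (natR-+ (a ℕ.* d) (b ℕ.* c)) (+-cong (natR-* a d) (natR-* b c)))))
                                              (sym (-‿*-expand _ _ _ _)) }
      ; -‿homo = λ { (a , b) → sym (⁻¹-anti-homo‿- (natR a) (natR b)) }
      ; 0-homo = -‿inverseʳ 0#
      ; 1-homo = trans (+-cong (+-identityʳ 1#) -0#≈0#) (+-identityʳ 1#) }

    ≟ℤ : ∀ x y → Maybe (⟦ x ⟧ℤ ≈ ⟦ y ⟧ℤ)
    ≟ℤ (a , b) (c , d) with a ℕ.+ d ≟ c ℕ.+ b
    ... | no _ = nothing
    ... | yes a+d≡c+b = just (begin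
      natR a - natR b                       ≈⟨ sym (-‿cancelʳ _ _ (natR d)) ⟩
      (natR a + natR d) - (natR b + natR d) ≈⟨ +-cong (trans (sym (natR-+ a d)) (trans (reflexive (≡.cong natR a+d≡c+b)) (natR-+ c b)))
                                                       (-‿cong (+-comm _ _)) ⟩
      (natR c + natR b) - (natR d + natR b) ≈⟨ -‿cancelʳ _ _ _ ⟩
      natR c - natR d                       ∎)

    open import Algebra.Solver.Ring ℤ-coprimes₂ (fromCommutativeRing R) ℤ-coprimes₂⟶R ≟ℤ public
      using (solve; _:=_; _:+_; _:*_; :-_; _:-_)

module Series {c ℓ : Level} (R : CommutativeRing c ℓ) where
  open CommutativeRing R hiding (zero)
  open WithRing R
  open RingArithmetic R
  open Solver
  open import Algebra.Properties.Ring ring using (-‿distribˡ-*; -0#≈0#)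
  open import Data.Nat.Properties as ℕₚ using ()
  open import Data.Nat.Combinatorics using (_C_; nCk+nC[k+1]≡[n+1]C[k+1])
  open import Relation.Binary.Reasoning.Setoid setoid

  sum-cong : ∀ n {f g : ℕ → Carrier} → (∀ k → k < n → f k ≈ g k) → sumBelow n f ≈ sumBelow n g
  sum-cong zero _ = refl
  sum-cong (suc n) f≈g = +-cong (sum-cong n (λ k k<n → f≈g k (ℕₚ.m<n⇒m<1+n k<n))) (f≈g n ℕₚ.≤-refl)

  sum-zero : ∀ n {f : ℕ → Carrier} → (∀ k → k < n → f k ≈ 0#) → sumBelow n f ≈ 0#
  sum-zero n f≈0 = trans (sum-cong n f≈0) (zeros n)
    where
    zeros : ∀ n → sumBelow n (λ _ → 0#) ≈ 0#
    zeros zero = refl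
    zeros (suc n) = trans (+-identityʳ _) (zeros n)

  sum-head : ∀ n (f : ℕ → Carrier) → sumBelow (suc n) f ≈ f 0 + sumBelow n (λ k → f (suc k))
  sum-head zero f = trans (+-identityˡ _) (sym (+-identityʳ _))
  sum-head (suc n) f = trans (+-congʳ (sum-head n f)) (+-assoc _ _ _)

  sum-+ : ∀ n (f g : ℕ → Carrier) → sumBelow n (λ k → f k + g k) ≈ sumBelow n f + sumBelow n g
  sum-+ zero f g = sym (+-identityʳ _)
  sum-+ (suc n) f g = trans (+-congʳ (sum-+ n f g)) (solve 4 (λ a b x y → (a :+ b) :+ (x :+ y) := (a :+ x) :+ (b :+ y)) refl _ _ _ _)

  sum-*ˡ : ∀ n a (f : ℕ → Carrier) → a * sumBelow n f ≈ sumBelow n (λ k → a * f k)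
  sum-*ˡ zero a f = zeroʳ a
  sum-*ˡ (suc n) a f = trans (distribˡ _ _ _) (+-congʳ (sum-*ˡ n a f))

  sum-neg : ∀ n (f : ℕ → Carrier) → - sumBelow n f ≈ sumBelow n (λ k → - f k)
  sum-neg zero f = -0#≈0#
  sum-neg (suc n) f = trans (solve 2 (λ a b → :- (a :+ b) := :- a :+ :- b) refl _ _) (+-congʳ (sum-neg n f))

  sum-vanishing-tail : ∀ k j {f : ℕ → Carrier} → (∀ i → k ≤ i → i < k ℕ.+ j → f i ≈ 0#) →
                       sumBelow (k ℕ.+ j) f ≈ sumBelow k f
  sum-vanishing-tail k zero {f} _ = reflexive (≡.cong (λ n → sumBelow n f) (ℕₚ.+-identityʳ k))
  sum-vanishing-tail k (suc j) {f} f≈0 = begin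
    sumBelow (k ℕ.+ suc j) f           ≡⟨ ≡.cong (λ n → sumBelow n f) (ℕₚ.+-suc k j) ⟩
    sumBelow (k ℕ.+ j) f + f (k ℕ.+ j) ≈⟨ +-cong (sum-vanishing-tail k j (λ i k≤i i<k+j → f≈0 i k≤i (ℕₚ.<-≤-trans i<k+j (ℕₚ.+-monoʳ-≤ k (ℕₚ.n≤1+n j)))))
                                                 (f≈0 (k ℕ.+ j) (ℕₚ.m≤m+n k j) (ℕₚ.+-monoʳ-< k (ℕₚ.n<1+n j))) ⟩
    sumBelow k f + 0#                  ≈⟨ +-identityʳ _ ⟩
    sumBelow k f                       ∎

  tail : Ser → Ser
  tail f k = f (suc k)

  shift : Ser → Ser
  shift f zero = 0#
  shift f (suc i) = f i

  shiftⁿ : ℕ → Ser → Ser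
  shiftⁿ zero f = f
  shiftⁿ (suc j) f = shift (shiftⁿ j f)

  shift-cong : ∀ {f g} → f ≋ g → shift f ≋ shift g
  shift-cong f≋g zero = refl
  shift-cong f≋g (suc i) = f≋g i

  shiftⁿ-cong : ∀ j {f g} → f ≋ g → shiftⁿ j f ≋ shiftⁿ j g
  shiftⁿ-cong zero f≋g = f≋g
  shiftⁿ-cong (suc j) f≋g = shift-cong (shiftⁿ-cong j f≋g)

  shift-⊕ : ∀ f g → shift (f ⊕ g) ≋ (shift f ⊕ shift g)
  shift-⊕ f g zero = sym (+-identityʳ 0#)
  shift-⊕ f g (suc i) = refl

  shiftⁿ-⊕ : ∀ j f g → shiftⁿ j (f ⊕ g) ≋ (shiftⁿ j f ⊕ shiftⁿ j g)
  shiftⁿ-⊕ zero f g = λ _ → refl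
  shiftⁿ-⊕ (suc j) f g i = trans (shift-cong (shiftⁿ-⊕ j f g) i) (shift-⊕ (shiftⁿ j f) (shiftⁿ j g) i)

  shiftⁿ-shift : ∀ j f → shiftⁿ j (shift f) ≋ shift (shiftⁿ j f)
  shiftⁿ-shift zero f = λ _ → refl
  shiftⁿ-shift (suc j) f = shift-cong (shiftⁿ-shift j f)

  shift-scale : ∀ a f → shift (scaleS a f) ≋ scaleS a (shift f)
  shift-scale a f zero = sym (zeroʳ a)
  shift-scale a f (suc i) = refl

  shiftⁿ-below : ∀ j f i → i < j → shiftⁿ j f i ≈ 0#
  shiftⁿ-below (suc j) f zero _ = refl
  shiftⁿ-below (suc j) f (suc i) (s≤s i<j) = shiftⁿ-below j f i i<j

  shiftⁿ-diagonal : ∀ j f → shiftⁿ j f j ≈ f 0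
  shiftⁿ-diagonal zero f = refl
  shiftⁿ-diagonal (suc j) f = shiftⁿ-diagonal j f

  ⊛-zero-index : ∀ f g → (f ⊛ g) 0 ≈ f 0 * g 0
  ⊛-zero-index f g = +-identityˡ _

  ⊛-suc-index : ∀ f g i → (f ⊛ g) (suc i) ≈ f 0 * g (suc i) + (tail f ⊛ g) i
  ⊛-suc-index f g i = sum-head (suc i) _

  ⊛-congˡ-upTo : ∀ i {f f′} g → (∀ k → k ≤ i → f k ≈ f′ k) → (f ⊛ g) i ≈ (f′ ⊛ g) i
  ⊛-congˡ-upTo i g f≈f′ = sum-cong (suc i) (λ k k≤i → *-congʳ (f≈f′ k (ℕₚ.≤-pred k≤i)))

  ⊛-congˡ : ∀ {f f′} g → f ≋ f′ → (f ⊛ g) ≋ (f′ ⊛ g)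
  ⊛-congˡ g f≋f′ i = ⊛-congˡ-upTo i g (λ k _ → f≋f′ k)

  ⊛-distribʳ-⊕ : ∀ f f′ g → ((f ⊕ f′) ⊛ g) ≋ ((f ⊛ g) ⊕ (f′ ⊛ g))
  ⊛-distribʳ-⊕ f f′ g i = trans (sum-cong (suc i) (λ k _ → distribʳ _ _ _)) (sum-+ (suc i) _ _)

  ⊛-⊖ˡ : ∀ f g → ((⊖ f) ⊛ g) ≋ (⊖ (f ⊛ g))
  ⊛-⊖ˡ f g i = trans (sum-cong (suc i) (λ k _ → sym (-‿distribˡ-* _ _))) (sym (sum-neg (suc i) _))

  ⊛-identityˡ : ∀ g → (oneS ⊛ g) ≋ g
  ⊛-identityˡ g zero = trans (⊛-zero-index oneS g) (*-identityˡ _)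
  ⊛-identityˡ g (suc i) =
    trans (⊛-suc-index oneS g i) (trans (+-cong (*-identityˡ _) (sum-zero (suc i) (λ k _ → zeroˡ _))) (+-identityʳ _))

  ⊛-identityʳ : ∀ f → (f ⊛ oneS) ≋ f
  ⊛-identityʳ f zero = trans (⊛-zero-index f oneS) (*-identityʳ _)
  ⊛-identityʳ f (suc i) = trans (⊛-suc-index f oneS i) (trans (+-cong (zeroʳ _) (⊛-identityʳ (tail f) i)) (+-identityˡ _))

  ⊛-shiftˡ : ∀ f g → (shift f ⊛ g) ≋ shift (f ⊛ g)
  ⊛-shiftˡ f g zero = trans (⊛-zero-index (shift f) g) (zeroˡ _)
  ⊛-shiftˡ f g (suc i) = trans (⊛-suc-index (shift f) g i) (trans (+-congʳ (zeroˡ _)) (+-identityˡ _))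

  q≋shift-one : qS ≋ shift oneS
  q≋shift-one zero = refl
  q≋shift-one (suc zero) = refl
  q≋shift-one (suc (suc i)) = refl

  q⊛ : ∀ g → (qS ⊛ g) ≋ shift g
  q⊛ g i = trans (⊛-congˡ g q≋shift-one i) (trans (⊛-shiftˡ oneS g i) (shift-cong (⊛-identityˡ g) i))

  q^j≋ : ∀ j → powS qS j ≋ shiftⁿ j oneS
  q^j≋ zero = λ _ → refl
  q^j≋ (suc j) i = trans (q⊛ (powS qS j) i) (shift-cong (q^j≋ j) i)

  q^j⊛ : ∀ j g → (powS qS j ⊛ g) ≋ shiftⁿ j g
  q^j⊛ j g i = trans (⊛-congˡ g (q^j≋ j) i) (monomial⊛ j i)
    where
    monomial⊛ : ∀ j → (shiftⁿ j oneS ⊛ g) ≋ shiftⁿ j g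
    monomial⊛ zero = ⊛-identityˡ g
    monomial⊛ (suc j) i = trans (⊛-shiftˡ (shiftⁿ j oneS) g i) (shift-cong (monomial⊛ j) i)

  monomial-above : ∀ j i → j < i → shiftⁿ j oneS i ≈ 0#
  monomial-above zero (suc i) _ = refl
  monomial-above (suc j) (suc i) (s≤s j<i) = monomial-above j i j<i

  ⊛-ones-prefix : ∀ i {f} g → (∀ k → k ≤ i → f k ≈ 1#) → (f ⊛ g) i ≈ g i + shift (f ⊛ g) i
  ⊛-ones-prefix zero {f} g ones =
    trans (⊛-zero-index f g) (trans (*-congʳ (ones 0 z≤n)) (trans (*-identityˡ _) (sym (+-identityʳ _))))
  ⊛-ones-prefix (suc i) {f} g ones = trans (⊛-suc-index f g i) (+-cong (trans (*-congʳ (ones 0 z≤n)) (*-identityˡ _))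
    (⊛-congˡ-upTo i g (λ k k≤i → trans (ones (suc k) (s≤s k≤i)) (sym (ones k (ℕₚ.m≤n⇒m≤1+n k≤i))))))

  1+q⊛ : ∀ g → ((oneS ⊕ qS) ⊛ g) ≋ (g ⊕ shift g)
  1+q⊛ g i = trans (⊛-distribʳ-⊕ oneS qS g i) (+-cong (⊛-identityˡ g i) (q⊛ g i))

  binomialRow : ℕ → Ser
  binomialRow k i = natR (k C i)

  binomialRow-suc : ∀ k → binomialRow (suc k) ≋ (binomialRow k ⊕ shift (binomialRow k))
  binomialRow-suc k zero = sym (+-identityʳ _)
  binomialRow-suc k (suc i) = begin
    natR (suc k C suc i)                ≡⟨ ≡.cong natR (≡.sym (nCk+nC[k+1]≡[n+1]C[k+1] k i)) ⟩
    natR (k C i ℕ.+ k C suc i)          ≈⟨ natR-+ (k C i) (k C suc i) ⟩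
    natR (k C i) + natR (k C suc i)     ≈⟨ +-comm _ _ ⟩
    natR (k C suc i) + natR (k C i)     ∎

  [1+q]^k≋ : ∀ k → powS (oneS ⊕ qS) k ≋ binomialRow k
  [1+q]^k≋ zero zero = sym (+-identityʳ 1#)
  [1+q]^k≋ zero (suc i) = refl
  [1+q]^k≋ (suc k) i = begin
    ((oneS ⊕ qS) ⊛ powS (oneS ⊕ qS) k) i               ≈⟨ 1+q⊛ (powS (oneS ⊕ qS) k) i ⟩
    (powS (oneS ⊕ qS) k ⊕ shift (powS (oneS ⊕ qS) k)) i ≈⟨ +-cong ([1+q]^k≋ k i) (shift-cong ([1+q]^k≋ k) i) ⟩
    (binomialRow k ⊕ shift (binomialRow k)) i          ≈⟨ sym (binomialRow-suc k i) ⟩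
    binomialRow (suc k) i                              ∎

  q^j[1+q]^k≋ : ∀ j k → (powS qS j ⊛ powS (oneS ⊕ qS) k) ≋ shiftⁿ j (binomialRow k)
  q^j[1+q]^k≋ j k i = trans (q^j⊛ j (powS (oneS ⊕ qS) k) i) (shiftⁿ-cong j ([1+q]^k≋ k) i)

module LucasCoefficients {c ℓ : Level} (R : CommutativeRing c ℓ) where
  open WithRing R using (binom2)
  open import Data.Nat using (_+_; _*_)
  open import Data.Nat.Properties
    using ( +-suc; +-comm; +-identityʳ; *-suc; suc-injective; m+n∸m≡n; +-∸-assoc
          ; n<1+n; m≤m+n; ≤-trans; ≤-pred; ≤-antisym; _≤?_; ≰⇒>)
  open import Data.Nat.Combinatorics using (_C_; nCk+nC[k+1]≡[n+1]C[k+1]; nC1≡n; k>n⇒nCk≡0)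
  open import Relation.Nullary using (yes; no)
  open ≡ using (refl; sym; trans; cong; cong₂; subst)

  binom2-vanish : ∀ k → binom2 (suc (2 * suc k)) (suc (suc k)) ≡ 0
  binom2-vanish k rewrite trans (m+n∸m≡n (suc k) (suc k + 0)) (+-identityʳ (suc k)) =
    cong₂ _+_ (k>n⇒nCk≡0 (n<1+n (suc k))) (k>n⇒nCk≡0 (n<1+n k))

  binom2-beyond : ∀ n k → 2 * suc k ≡ 3 + n → binom2 (2 + n) (suc k) ≡ 0
  binom2-beyond n zero ()
  binom2-beyond n (suc k) 2k+4≡n+3 =
    subst (λ m → binom2 m (suc (suc k)) ≡ 0) (suc-injective (trans (sym (*-suc 2 (suc k))) 2k+4≡n+3)) (binom2-vanish k)

  binom2-rec : ∀ n k → 2 * suc k ≤ 3 + n → binom2 (3 + n) (suc k) ≡ binom2 (2 + n) (suc k) + binom2 (1 + n) k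
  binom2-rec n zero _ rewrite nC1≡n (2 + n) | nC1≡n (1 + n) = cong suc (sym (+-comm (n + 1) 1))
  binom2-rec zero (suc k) le with subst (_≤ 3) (*-suc 2 (suc k)) le
  ... | s≤s (s≤s (s≤s le′)) with subst (_≤ 0) (+-suc k (k + 0)) le′
  ... | ()
  binom2-rec (suc n) (suc k) le =
    pascal² (≤-trans (m≤m+n k (k + 0)) (≤-pred (≤-pred (subst (_≤ 2 + n) (*-suc 2 k) (≤-pred (≤-pred (subst (_≤ 4 + n) (*-suc 2 (suc k)) le)))))))
    where
    pascal² : k ≤ n → binom2 (4 + n) (2 + k) ≡ binom2 (3 + n) (2 + k) + binom2 (2 + n) (suc k)
    pascal² k≤n rewrite +-∸-assoc 2 k≤n | +-∸-assoc 1 k≤n =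
      trans (cong₂ _+_ (sym (nCk+nC[k+1]≡[n+1]C[k+1] (suc b) (suc k))) (sym (nCk+nC[k+1]≡[n+1]C[k+1] b k)))
            ([w+x]+[y+z]≡[x+z]+[w+y] (suc b C suc k) (suc b C suc (suc k)) (b C k) (b C suc k))
      where b = n ∸ k

  vCoeff≡binom2-leading : ∀ n k → 2 * suc k ≤ 3 + n → (2 * suc k ≤ 2 + n → vCoeff (2 + n) (suc k) ≡ binom2 (2 + n) (suc k)) →
                          vCoeff (2 + n) (suc k) ≡ binom2 (2 + n) (suc k)
  vCoeff≡binom2-leading n k le below with 2 * suc k ≤? 2 + n
  ... | yes le′ = below le′
  ... | no ≰ = trans (vCoeff-vanish (2 + n) (suc k) (≰⇒> ≰)) (sym (binom2-beyond n k (≤-antisym le (≰⇒> ≰))))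

  vCoeff≡binom2 : ∀ n j → 2 * j ≤ suc n → vCoeff (suc n) j ≡ binom2 (suc n) j
  vCoeff≡binom2 n zero _ = vCoeff-suc-zero n
  vCoeff≡binom2 zero (suc j) le with subst (_≤ 1) (*-suc 2 j) le
  ... | s≤s ()
  vCoeff≡binom2 (suc zero) (suc zero) _ = refl
  vCoeff≡binom2 (suc zero) (suc (suc j)) le with subst (_≤ 2) (*-suc 2 (suc j)) le
  ... | s≤s (s≤s le′) with subst (_≤ 0) (*-suc 2 j) le′
  ... | ()
  vCoeff≡binom2 (suc (suc n)) (suc k) le =
    trans (cong₂ _+_ (vCoeff≡binom2-leading n k le (vCoeff≡binom2 (suc n) (suc k)))
                     (vCoeff≡binom2 n k (≤-pred (≤-pred (subst (_≤ 3 + n) (*-suc 2 k) le)))))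
          (sym (binom2-rec n k le))

module Expansion {c ℓ : Level} (R : CommutativeRing c ℓ) where
  open CommutativeRing R hiding (zero)
  open WithRing R
  open RingArithmetic R
  open Solver
  open Series R
  open import Data.Nat.Properties as ℕₚ using ()
  open import Relation.Nullary using (yes; no)
  open import Algebra.Properties.AbelianGroup +-abelianGroup using (∙-cancelˡ)
  open import Data.Nat.Induction using (<-rec)
  open import Relation.Binary.Reasoning.Setoid setoid

  lincomb : ℕ → (ℕ → Carrier) → (ℕ → Ser) → Ser
  lincomb B a v k = sumBelow B (λ j → a j * v j k)

  record IsLinear (X : Ser → Ser) : Set (c Level.⊔ ℓ) where
    field
      cong       : ∀ {f g} → f ≋ g → X f ≋ X g
      ⊕-homo     : ∀ f g → X (f ⊕ g) ≋ (X f ⊕ X g)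
      scale-homo : ∀ a f → X (scaleS a f) ≋ scaleS a (X f)

    zero-homo : X (λ _ → 0#) ≋ (λ _ → 0#)
    zero-homo i = trans (cong (λ _ → sym (zeroˡ 0#)) i) (trans (scale-homo 0# (λ _ → 0#) i) (zeroˡ _))

    lincomb-homo : ∀ B a v → X (lincomb B a v) ≋ lincomb B a (λ j → X (v j))
    lincomb-homo zero a v = zero-homo
    lincomb-homo (suc B) a v i =
      trans (⊕-homo (lincomb B a v) (scaleS (a B) (v B)) i) (+-cong (lincomb-homo B a v i) (scale-homo (a B) (v B) i))

  lincomb-cong : ∀ B {a b : ℕ → Carrier} {v w : ℕ → Ser} →
                 (∀ j → j < B → a j ≈ b j) → (∀ j → j < B → v j ≋ w j) → lincomb B a v ≋ lincomb B b w
  lincomb-cong B a≈b v≋w i = sum-cong B (λ j j<B → *-cong (a≈b j j<B) (v≋w j j<B i))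

  scaleS-linear : ∀ a → IsLinear (scaleS a)
  scaleS-linear a = record
    { cong       = λ f≋g i → *-congˡ (f≋g i)
    ; ⊕-homo     = λ f g i → distribˡ a (f i) (g i)
    ; scale-homo = λ b f i → solve 3 (λ a b x → a :* (b :* x) := b :* (a :* x)) refl a b (f i)
    }

  -- E n j stands for X^(n-2j) Y^j applied to a fixed series, and V n for V_n(X, Y) applied to it.
  module CompanionLucasExpansion
    {X Y : Ser → Ser} (X-linear : IsLinear X) (Y-linear : IsLinear Y)
    (E : ℕ → ℕ → Ser)
    (E-X : ∀ n j → 2 ℕ.* j ≤ n → E (suc n) j ≋ X (E n j))
    (E-Y : ∀ n j → E (2 ℕ.+ n) (suc j) ≋ Y (E n j))
    (V : ℕ → Ser)
    (V-rec : ∀ n → V (2 ℕ.+ n) ≋ (X (V (suc n)) ⊕ Y (V n)))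
    (V-0 : V 0 ≋ (E 0 0 ⊕ E 0 0))
    (V-1 : V 1 ≋ E 1 0)
    where

    private
      module X = IsLinear X-linear
      module Y = IsLinear Y-linear

    expanded : ℕ → ℕ → Ser
    expanded B n = lincomb B (λ j → natR (vCoeff n j)) (E n)

    expanded-rec : ∀ B n → expanded (suc B) (2 ℕ.+ n) ≋ (X (expanded (suc B) (suc n)) ⊕ Y (expanded B n))
    expanded-rec B n i = begin
      expanded (suc B) (2 ℕ.+ n) i
        ≈⟨ sum-head B _ ⟩
      d₁ 0 * E₂ 0 i + sumBelow B (λ j → natR (vCoeff (suc n) (suc j) ℕ.+ vCoeff n j) * E₂ (suc j) i)
        ≈⟨ +-congˡ (trans (sum-cong B (λ j _ → trans (*-congʳ (natR-+ (vCoeff (suc n) (suc j)) (vCoeff n j))) (distribʳ _ _ _)))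
                          (sum-+ B _ _)) ⟩
      d₁ 0 * E₂ 0 i + (sumBelow B (λ j → d₁ (suc j) * E₂ (suc j) i) + sumBelow B (λ j → d₀ j * E₂ (suc j) i))
        ≈⟨ sym (+-assoc _ _ _) ⟩
      (d₁ 0 * E₂ 0 i + sumBelow B (λ j → d₁ (suc j) * E₂ (suc j) i)) + sumBelow B (λ j → d₀ j * E₂ (suc j) i)
        ≈⟨ +-cong (sym (sum-head B (λ j → d₁ j * E₂ j i))) (sum-cong B (λ j _ → *-congˡ (E-Y n j i))) ⟩
      sumBelow (suc B) (λ j → d₁ j * E₂ j i) + lincomb B d₀ (λ j → Y (E n j)) i
        ≈⟨ +-congʳ (sum-cong (suc B) (λ j _ → raise j)) ⟩
      lincomb (suc B) d₁ (λ j → X (E (suc n) j)) i + lincomb B d₀ (λ j → Y (E n j)) i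
        ≈⟨ sym (+-cong (X.lincomb-homo (suc B) d₁ (E (suc n)) i) (Y.lincomb-homo B d₀ (E n) i)) ⟩
      X (expanded (suc B) (suc n)) i + Y (expanded B n) i ∎
      where
      d₀ d₁ : ℕ → Carrier
      d₀ j = natR (vCoeff n j)
      d₁ j = natR (vCoeff (suc n) j)
      E₂ = E (2 ℕ.+ n)
      raise : ∀ j → d₁ j * E₂ j i ≈ d₁ j * X (E (suc n) j) i
      raise j with 2 ℕ.* j ℕₚ.≤? suc n
      ... | yes le = *-congˡ (E-X (suc n) j le i)
      ... | no ≰ rewrite vCoeff-vanish (suc n) j (ℕₚ.≰⇒> ≰) = trans (zeroˡ _) (sym (zeroˡ _))

    expansion : ∀ n B → n < 2 ℕ.* B → expanded B n ≋ V n
    expansion 0 (suc B) _ i =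
      trans (sum-head B _) (trans (+-cong twice (sum-zero B (λ j _ → zeroˡ _))) (trans (+-identityʳ _) (sym (V-0 i))))
      where
      twice : natR 2 * E 0 0 i ≈ E 0 0 i + E 0 0 i
      twice = trans (*-congʳ (+-congˡ (+-identityʳ 1#))) (trans (distribʳ _ _ _) (+-cong (*-identityˡ _) (*-identityˡ _)))
    expansion 1 (suc B) _ i =
      trans (sum-head B _) (trans (+-cong once (sum-zero B (λ j _ → zeroˡ _))) (trans (+-identityʳ _) (sym (V-1 i))))
      where
      once : natR 1 * E 1 0 i ≈ E 1 0 i
      once = trans (*-congʳ (+-identityʳ 1#)) (*-identityˡ _)
    expansion (suc (suc n)) (suc B) n+2<2B+2 i = begin
      expanded (suc B) (2 ℕ.+ n) i                        ≈⟨ expanded-rec B n i ⟩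
      X (expanded (suc B) (suc n)) i + Y (expanded B n) i ≈⟨ +-cong (X.cong (expansion (suc n) (suc B) (ℕₚ.<-trans (ℕₚ.n<1+n _) n+2<2B+2)) i)
                                                                     (Y.cong (expansion n B n<2B) i) ⟩
      X (V (suc n)) i + Y (V n) i                         ≈⟨ sym (V-rec n i) ⟩
      V (2 ℕ.+ n) i                                       ∎
      where
      n<2B : n < 2 ℕ.* B
      n<2B = ℕₚ.≤-pred (ℕₚ.≤-pred (≡.subst (3 ℕ.+ n ≤_) (ℕₚ.*-suc 2 B) n+2<2B+2))

  module TriangularUniqueness
    (e : ℕ → Ser) (e-below : ∀ j i → i < j → e j i ≈ 0#) (e-diagonal : ∀ i → e i i ≈ 1#) (B : ℕ) where

    lincomb-truncate : ∀ z i → i < B → lincomb B z e i ≈ sumBelow i (λ j → z j * e j i) + z i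
    lincomb-truncate z i i<B = begin
      sumBelow B f                           ≡⟨ ≡.cong (λ n → sumBelow n f) (≡.sym (ℕₚ.m+[n∸m]≡n i<B)) ⟩
      sumBelow (suc i ℕ.+ (B ∸ suc i)) f     ≈⟨ sum-vanishing-tail (suc i) (B ∸ suc i) (λ j i<j _ → trans (*-congˡ (e-below j i i<j)) (zeroʳ _)) ⟩
      sumBelow i f + z i * e i i             ≈⟨ +-congˡ (trans (*-congˡ (e-diagonal i)) (*-identityʳ _)) ⟩
      sumBelow i f + z i                     ∎
      where f = λ j → z j * e j i

    coefficients-unique : ∀ {x y} → (∀ i → i < B → lincomb B x e i ≈ lincomb B y e i) → ∀ j → j < B → x j ≈ y j
    coefficients-unique {x} {y} same = <-rec (λ i → i < B → x i ≈ y i) step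
      where
      step : ∀ i → (∀ {j} → j < i → j < B → x j ≈ y j) → i < B → x i ≈ y i
      step i earlier i<B = ∙-cancelˡ (sumBelow i (λ j → y j * e j i)) (x i) (y i) (begin
        sumBelow i (λ j → y j * e j i) + x i ≈⟨ +-congʳ (sum-cong i (λ j j<i → *-congʳ (sym (earlier j<i (ℕₚ.<-trans j<i i<B))))) ⟩
        sumBelow i (λ j → x j * e j i) + x i ≈⟨ sym (lincomb-truncate x i i<B) ⟩
        lincomb B x e i                      ≈⟨ same i i<B ⟩
        lincomb B y e i                      ≈⟨ lincomb-truncate y i i<B ⟩
        sumBelow i (λ j → y j * e j i) + y i ∎)

module AtomExpansion {c ℓ : Level} (R : CommutativeRing c ℓ) where
  open CommutativeRing R hiding (zero)
  open WithRing R
  open RingArithmetic R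
  open Solver
  open Series R
  open Expansion R
  open import Algebra.Properties.Ring ring using (-1*x≈-x; -‿distribʳ-*)
  open import Algebra.Properties.AbelianGroup +-abelianGroup using (⁻¹-∙-comm)
  open import Data.Nat.Properties as ℕₚ using ()
  open import Relation.Binary.Reasoning.Setoid setoid

  atom : ℕ → ℕ → Ser
  atom n j = shiftⁿ j (binomialRow (n ∸ 2 ℕ.* j))

  times[1+q] : Ser → Ser
  times[1+q] f = f ⊕ shift f

  times[-q] : Ser → Ser
  times[-q] f = ⊖ shift f

  times[1+q]-linear : IsLinear times[1+q]
  times[1+q]-linear = record
    { cong       = λ f≋g i → +-cong (f≋g i) (shift-cong f≋g i)
    ; ⊕-homo     = λ f g i → trans (+-congˡ (shift-⊕ f g i))
                                     (solve 4 (λ a b c d → (a :+ b) :+ (c :+ d) := (a :+ c) :+ (b :+ d)) refl _ _ _ _)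
    ; scale-homo = λ a f i → trans (+-congˡ (shift-scale a f i)) (sym (distribˡ a _ _))
    }

  times[-q]-linear : IsLinear times[-q]
  times[-q]-linear = record
    { cong       = λ f≋g i → -‿cong (shift-cong f≋g i)
    ; ⊕-homo     = λ f g i → trans (-‿cong (shift-⊕ f g i)) (sym (⁻¹-∙-comm _ _))
    ; scale-homo = λ a f i → trans (-‿cong (shift-scale a f i)) (-‿distribʳ-* a _)
    }

  atom-suc : ∀ n j → 2 ℕ.* j ≤ n → atom (suc n) j ≋ times[1+q] (atom n j)
  atom-suc n j 2j≤n i = begin
    shiftⁿ j (binomialRow (suc n ∸ 2 ℕ.* j)) i                           ≡⟨ ≡.cong (λ k → shiftⁿ j (binomialRow k) i) (ℕₚ.+-∸-assoc 1 2j≤n) ⟩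
    shiftⁿ j (binomialRow (suc k)) i                                     ≈⟨ shiftⁿ-cong j (binomialRow-suc k) i ⟩
    shiftⁿ j (binomialRow k ⊕ shift (binomialRow k)) i                   ≈⟨ shiftⁿ-⊕ j _ _ i ⟩
    shiftⁿ j (binomialRow k) i + shiftⁿ j (shift (binomialRow k)) i      ≈⟨ +-congˡ (shiftⁿ-shift j _ i) ⟩
    times[1+q] (atom n j) i                                              ∎
    where k = n ∸ 2 ℕ.* j

  atom-suc-suc : ∀ n j → atom (2 ℕ.+ n) (suc j) ≋ shift (atom n j)
  atom-suc-suc n j i = reflexive (≡.cong (λ k → shift (shiftⁿ j (binomialRow k)) i) (≡.cong (2 ℕ.+ n ∸_) (ℕₚ.*-suc 2 j)))

  -- V_n(1 + q, -q) = 1 + q^n, as 1 and q are the roots of z² - (1 + q) z + q.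
  signed-atom-expansion : ∀ n B → n < 2 ℕ.* B →
    lincomb B (λ j → pow (- 1#) j * natR (vCoeff n j)) (atom n) ≋ (oneS ⊕ shiftⁿ n oneS)
  signed-atom-expansion n B n<2B i = trans (sum-cong B (λ j _ → solve 3 (λ σ d a → (σ :* d) :* a := d :* (σ :* a)) refl _ _ _))
                                          (expansion n B n<2B i)
    where
    E : ℕ → ℕ → Ser
    E n j = scaleS (pow (- 1#) j) (atom n j)

    E-X : ∀ n j → 2 ℕ.* j ≤ n → E (suc n) j ≋ times[1+q] (E n j)
    E-X n j 2j≤n i = trans (*-congˡ (atom-suc n j 2j≤n i)) (sym (IsLinear.scale-homo times[1+q]-linear _ (atom n j) i))

    E-Y : ∀ n j → E (2 ℕ.+ n) (suc j) ≋ times[-q] (E n j)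
    E-Y n j i = begin
      (- 1# * pow (- 1#) j) * atom (2 ℕ.+ n) (suc j) i ≈⟨ trans (*-assoc _ _ _) (-1*x≈-x _) ⟩
      - (pow (- 1#) j * atom (2 ℕ.+ n) (suc j) i)     ≈⟨ -‿cong (trans (*-congˡ (atom-suc-suc n j i)) (sym (shift-scale _ (atom n j) i))) ⟩
      times[-q] (E n j) i                             ∎

    one+q^ : ℕ → Ser
    one+q^ n = oneS ⊕ shiftⁿ n oneS

    one+q^-rec : ∀ n → one+q^ (2 ℕ.+ n) ≋ (times[1+q] (one+q^ (suc n)) ⊕ times[-q] (one+q^ n))
    one+q^-rec n i = trans (solve 4 (λ a b c d → a :+ d := ((a :+ b) :+ (c :+ d)) :- (c :+ b)) refl _ _ _ _)
                           (+-cong (+-congˡ (sym (shift-⊕ oneS _ i))) (-‿cong (sym (shift-⊕ oneS _ i))))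

    row₀ : binomialRow 0 ≋ oneS
    row₀ zero = +-identityʳ 1#
    row₀ (suc i) = refl

    E₀₀ : E 0 0 ≋ oneS
    E₀₀ i = trans (*-identityˡ _) (row₀ i)

    E₁₀ : E 1 0 ≋ one+q^ 1
    E₁₀ i = trans (*-identityˡ _) (trans (binomialRow-suc 0 i) (+-cong (row₀ i) (shift-cong row₀ i)))

    open CompanionLucasExpansion times[1+q]-linear times[-q]-linear E E-X E-Y one+q^ one+q^-rec
      (λ i → sym (+-cong (E₀₀ i) (E₀₀ i))) (λ i → sym (E₁₀ i))

module CompanionLucas {c ℓ : Level} (R : CommutativeRing c ℓ) (s t : CommutativeRing.Carrier R) where
  open CommutativeRing R hiding (zero)
  open WithRing R
  open RingArithmetic R
  open Solver
  open Series R
  open Expansion R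
  open import Data.Nat.Properties as ℕₚ using ()
  open import Relation.Binary.Reasoning.Setoid setoid

  signs-cancel : ∀ j → pow (- 1#) j * pow (- t) j ≈ pow t j
  signs-cancel zero = *-identityˡ 1#
  signs-cancel (suc j) = begin
    (- 1# * pow (- 1#) j) * (- t * pow (- t) j)
      ≈⟨ solve 4 (λ o a t b → (:- o :* a) :* (:- t :* b) := (o :* t) :* (a :* b)) refl 1# _ t _ ⟩
    (1# * t) * (pow (- 1#) j * pow (- t) j)     ≈⟨ *-cong (*-identityˡ t) (signs-cancel j) ⟩
    t * pow t j                                 ∎

  lucasV : ℕ → Carrier
  lucasV 0 = 1# + 1#
  lucasV 1 = s
  lucasV (suc (suc n)) = s * lucasV (suc n) + t * lucasV n

  lucas₂≈s : lucas 2 s t ≈ s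
  lucas₂≈s = trans (+-cong (*-identityʳ s) (zeroʳ t)) (+-identityʳ s)

  lucasV≈lucas : ∀ n → lucasV (suc n) ≈ lucas (2 ℕ.+ n) s t + t * lucas n s t
  lucasV≈lucas 0 = sym (trans (+-cong lucas₂≈s (zeroʳ t)) (+-identityʳ s))
  lucasV≈lucas 1 = sym (trans (+-congʳ (+-congʳ (*-congˡ lucas₂≈s)))
                              (solve 3 (λ s t o → (s :* s :+ t :* o) :+ t :* o := s :* s :+ t :* (o :+ o)) refl s t 1#))
  lucasV≈lucas (suc (suc n)) = begin
    s * lucasV (2 ℕ.+ n) + t * lucasV (suc n)
      ≈⟨ +-cong (*-congˡ (lucasV≈lucas (suc n))) (*-congˡ (lucasV≈lucas n)) ⟩
    s * (L₃ + t * L₁) + t * (L₂ + t * L₀)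
      ≈⟨ solve 6 (λ s t l₃ l₂ l₁ l₀ → s :* (l₃ :+ t :* l₁) :+ t :* (l₂ :+ t :* l₀)
                                       := (s :* l₃ :+ t :* l₂) :+ t :* (s :* l₁ :+ t :* l₀)) refl s t L₃ L₂ L₁ L₀ ⟩
    lucas (4 ℕ.+ n) s t + t * lucas (2 ℕ.+ n) s t ∎
    where
    L₀ = lucas n s t
    L₁ = lucas (1 ℕ.+ n) s t
    L₂ = lucas (2 ℕ.+ n) s t
    L₃ = lucas (3 ℕ.+ n) s t

  lucasV-expansion : ∀ n B → n < 2 ℕ.* B →
                     sumBelow B (λ j → natR (vCoeff n j) * (pow s (n ∸ 2 ℕ.* j) * pow t j)) ≈ lucasV n
  lucasV-expansion n B n<2B = expansion n B n<2B 0
    where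
    E : ℕ → ℕ → Ser
    E n j _ = pow s (n ∸ 2 ℕ.* j) * pow t j

    E-X : ∀ n j → 2 ℕ.* j ≤ n → E (suc n) j ≋ scaleS s (E n j)
    E-X n j 2j≤n _ = trans (reflexive (≡.cong (λ k → pow s k * pow t j) (ℕₚ.+-∸-assoc 1 2j≤n))) (*-assoc _ _ _)

    E-Y : ∀ n j → E (2 ℕ.+ n) (suc j) ≋ scaleS t (E n j)
    E-Y n j _ = trans (reflexive (≡.cong (λ k → pow s k * pow t (suc j)) (≡.cong (2 ℕ.+ n ∸_) (ℕₚ.*-suc 2 j))))
                      (solve 3 (λ a t b → a :* (t :* b) := t :* (a :* b)) refl _ t _)

    open CompanionLucasExpansion (scaleS-linear s) (scaleS-linear t) E E-X E-Y (λ n _ → lucasV n) (λ n _ → refl)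
      (λ _ → sym (+-cong (*-identityʳ 1#) (*-identityʳ 1#))) (λ _ → sym (trans (*-identityʳ _) (*-identityʳ s)))

module Cyclotomic {c ℓ : Level} (R : CommutativeRing c ℓ) {Φ : ℕ → WithRing.Ser R} (cyclotomic : WithRing.IsCyclotomic R Φ) where
  open CommutativeRing R hiding (zero)
  open WithRing R
  open RingArithmetic R
  open Solver
  open Series R
  open import Algebra.Properties.Ring ring using (-‿involutive; -0#≈0#)
  open import Data.Nat.Properties as ℕₚ using ()
  open import Data.Product using (_×_; _,_; proj₁; proj₂)
  open import Relation.Binary.Reasoning.Setoid setoid

  q^n-1 : ℕ → Ser
  q^n-1 n = powS qS n ⊕ (⊖ oneS)

  Φ₁⊛ : ∀ g → (Φ 1 ⊛ g) ≋ (shift g ⊕ (⊖ g))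
  Φ₁⊛ g i = begin
    (Φ 1 ⊛ g) i                    ≈⟨ ⊛-congˡ g Φ₁≋ i ⟩
    ((qS ⊕ (⊖ oneS)) ⊛ g) i        ≈⟨ ⊛-distribʳ-⊕ qS (⊖ oneS) g i ⟩
    (qS ⊛ g) i + ((⊖ oneS) ⊛ g) i  ≈⟨ +-cong (q⊛ g i) (trans (⊛-⊖ˡ oneS g i) (-‿cong (⊛-identityˡ g i))) ⟩
    shift g i - g i                ∎
    where
    Φ₁≋ : Φ 1 ≋ (qS ⊕ (⊖ oneS))
    Φ₁≋ k = trans (sym (⊛-identityʳ (Φ 1) k)) (trans (cyclotomic 0 k) (+-congʳ (⊛-identityʳ qS k)))

  geometric : ∀ n {g} → (Φ 1 ⊛ g) ≋ q^n-1 (suc n) → (∀ i → i ≤ n → g i ≈ 1#) × (∀ i → n < i → g i ≈ 0#)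
  geometric n {g} q-1⊛g≋ = up-to-n , beyond-n
    where
    g-zero : g 0 ≈ 1#
    g-zero = begin
      g 0                         ≈⟨ sym (-‿involutive _) ⟩
      - - g 0                     ≈⟨ -‿cong (sym (+-identityˡ _)) ⟩
      - (0# - g 0)                ≈⟨ -‿cong (trans (sym (Φ₁⊛ g 0)) (q-1⊛g≋ 0)) ⟩
      - (powS qS (suc n) 0 - 1#)  ≈⟨ -‿cong (trans (+-congʳ (q^j≋ (suc n) 0)) (+-identityˡ _)) ⟩
      - - 1#                      ≈⟨ -‿involutive _ ⟩
      1#                          ∎
    g-suc : ∀ i → g (suc i) ≈ g i - shiftⁿ n oneS i
    g-suc i = begin
      g (suc i)                           ≈⟨ solve 2 (λ a b → a := b :- (b :- a)) refl _ _ ⟩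
      g i - (g i - g (suc i))             ≈⟨ +-congˡ (-‿cong (trans (sym (Φ₁⊛ g (suc i))) (q-1⊛g≋ (suc i)))) ⟩
      g i - (powS qS (suc n) (suc i) - 0#) ≈⟨ +-congˡ (-‿cong (trans (+-cong (q^j≋ (suc n) (suc i)) -0#≈0#) (+-identityʳ _))) ⟩
      g i - shiftⁿ n oneS i               ∎
    up-to-n : ∀ i → i ≤ n → g i ≈ 1#
    up-to-n zero _ = g-zero
    up-to-n (suc i) i<n =
      trans (g-suc i) (trans (+-cong (up-to-n i (ℕₚ.<⇒≤ i<n)) (trans (-‿cong (shiftⁿ-below n oneS i i<n)) -0#≈0#)) (+-identityʳ _))
    beyond-n : ∀ i → n < i → g i ≈ 0#
    beyond-n (suc i) (s≤s n≤i) with ℕₚ.m≤n⇒m<n∨m≡n n≤i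
    ... | inj₁ n<i =
      trans (g-suc i) (trans (+-cong (beyond-n i n<i) (trans (-‿cong (monomial-above n i n<i)) -0#≈0#)) (+-identityʳ _))
    ... | inj₂ ≡.refl = trans (g-suc n) (trans (+-cong (up-to-n n ℕₚ.≤-refl) (-‿cong (shiftⁿ-diagonal n oneS))) (-‿inverseʳ _))

  Φ₂⊛ : ∀ g → (Φ 2 ⊛ g) ≋ (g ⊕ shift g)
  Φ₂⊛ g i = trans (⊛-congˡ g Φ₂≋ i) (1+q⊛ g i)
    where
    coefficients = geometric 1 {Φ 2 ⊛ oneS} (cyclotomic 1)
    Φ₂≋ : Φ 2 ≋ (oneS ⊕ qS)
    Φ₂≋ k = trans (sym (⊛-identityʳ (Φ 2) k)) (by-index k)
      where
      by-index : ∀ k → (Φ 2 ⊛ oneS) k ≈ (oneS ⊕ qS) k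
      by-index 0 = trans (proj₁ coefficients 0 z≤n) (sym (+-identityʳ _))
      by-index 1 = trans (proj₁ coefficients 1 ℕₚ.≤-refl) (sym (+-identityˡ _))
      by-index (suc (suc k)) = trans (proj₂ coefficients (2 ℕ.+ k) (s≤s (s≤s z≤n))) (sym (+-identityʳ _))

  module AtOddPrime (m : ℕ) (p-prime : Prime (suc (suc m ℕ.+ suc m))) where
    open OddPrime m p-prime using (h; p; N; p<N; divisors-p; divisors-2p)

    Φp-below-p : ∀ k → k < p → Φ p k ≈ 1#
    Φp-below-p k k<p =
      trans (sym (⊛-identityʳ (Φ p) k)) (proj₁ (geometric (h ℕ.+ h) {Φ p ⊛ oneS} q-1⊛Φp≋) k (ℕₚ.≤-pred k<p))
      where
      q-1⊛Φp≋ : (Φ 1 ⊛ (Φ p ⊛ oneS)) ≋ q^n-1 p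
      q-1⊛Φp≋ = ≡.subst (λ ds → prodS ds Φ ≋ q^n-1 p) divisors-p (cyclotomic (h ℕ.+ h))

    -- Below p, U = Φ_p Φ_2p is the sequence of partial sums of Φ_2p, and W = Φ_2 U = 1 + q + ... + q^(2p-1)
    -- below 2p; hence (1 + q) Φ_2p = U - q² U = W - q W there.
    [1+q]Φ2p-below-p : ∀ i → i < p → ((oneS ⊕ qS) ⊛ Φ N) i ≈ oneS i
    [1+q]Φ2p-below-p i i<p = begin
      ((oneS ⊕ qS) ⊛ Φ N) i            ≈⟨ trans (1+q⊛ (Φ N) i) (+-cong (sym (⊛-identityʳ (Φ N) i))
                                                                          (shift-cong (λ k → sym (⊛-identityʳ (Φ N) k)) i)) ⟩
      V i + shift V i                  ≈⟨ +-cong (V≈ i i<p) (shift-V≈ i i<p) ⟩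
      (U i - sU i) + (sU i - ssU i)    ≈⟨ solve 3 (λ a b c → (a :- b) :+ (b :- c) := (a :+ b) :- (b :+ c)) refl _ _ _ ⟩
      (U i + sU i) - (sU i + ssU i)    ≈⟨ sym (+-cong (Φ₂⊛ U i) (-‿cong (trans (shift-cong (Φ₂⊛ U) i) (shift-⊕ U (shift U) i)))) ⟩
      W i - shift W i                  ≈⟨ telescope i (ℕₚ.<-trans i<p p<N) ⟩
      oneS i                           ∎
      where
      V U W sU ssU : Ser
      V = Φ N ⊛ oneS
      U = Φ p ⊛ V
      W = Φ 2 ⊛ U
      sU = shift U
      ssU = shift sU
      W≈1 : ∀ i → i < N → W i ≈ 1#
      W≈1 i i<N = proj₁ (geometric (h ℕ.+ h ℕ.+ (p ℕ.+ 0)) {W} q-1⊛W≋) i (ℕₚ.≤-pred i<N)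
        where
        q-1⊛W≋ : (Φ 1 ⊛ W) ≋ q^n-1 N
        q-1⊛W≋ = ≡.subst (λ ds → prodS ds Φ ≋ q^n-1 N) divisors-2p (cyclotomic (h ℕ.+ h ℕ.+ (p ℕ.+ 0)))
      V≈ : ∀ i → i < p → V i ≈ U i - sU i
      V≈ i i<p = trans (solve 2 (λ v s → v := (v :+ s) :- s) refl (V i) (sU i))
                       (+-congʳ (sym (⊛-ones-prefix i V (λ k k≤i → Φp-below-p k (ℕₚ.≤-<-trans k≤i i<p)))))
      shift-V≈ : ∀ i → i < p → shift V i ≈ sU i - ssU i
      shift-V≈ zero _ = sym (-‿inverseʳ 0#)
      shift-V≈ (suc i) i+1<p = V≈ i (ℕₚ.<-trans (ℕₚ.n<1+n i) i+1<p)
      telescope : ∀ i → i < N → W i - shift W i ≈ oneS i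
      telescope zero 0<N = trans (+-cong (W≈1 0 0<N) -0#≈0#) (+-identityʳ _)
      telescope (suc i) i+1<N = trans (+-cong (W≈1 (suc i) i+1<N) (-‿cong (W≈1 i (ℕₚ.<-trans (ℕₚ.n<1+n i) i+1<N)))) (-‿inverseʳ _)

module OddPrimeAtom {c ℓ : Level} (R : CommutativeRing c ℓ) (m : ℕ) (p-prime : Prime (suc (suc m ℕ.+ suc m)))
  {Φ : ℕ → WithRing.Ser R} (cyclotomic : WithRing.IsCyclotomic R Φ) {γ : ℕ → CommutativeRing.Carrier R}
  (γ-expansion : WithRing.IsAtomExpansion R (φ (2 ℕ.* suc (suc m ℕ.+ suc m))) (Φ (2 ℕ.* suc (suc m ℕ.+ suc m))) γ) where
  open CommutativeRing R hiding (zero)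
  open WithRing R
  open RingArithmetic R
  open Solver
  open Series R
  open Expansion R
  open AtomExpansion R
  open LucasCoefficients R using (vCoeff≡binom2)
  open Cyclotomic R cyclotomic using (module AtOddPrime)
  open AtOddPrime m p-prime using ([1+q]Φ2p-below-p)
  open OddPrime m p-prime using (h; p; N; φ-2p)
  open import Data.Nat.Properties as ℕₚ using ()
  open import Relation.Binary.Reasoning.Setoid setoid

  K B : ℕ
  K = h ℕ.+ h
  B = suc h

  B≤p : B ≤ p
  B≤p = s≤s (ℕₚ.m≤m+n h h)

  p<2B : p < 2 ℕ.* B
  p<2B = ℕₚ.≤-reflexive (≡.sym (≡.trans (ℕₚ.*-suc 2 h) (≡.cong (λ k → 2 ℕ.+ (h ℕ.+ k)) (ℕₚ.+-identityʳ h))))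

  2j≤K : ∀ j → j < B → 2 ℕ.* j ≤ K
  2j≤K j (s≤s j≤h) = ℕₚ.≤-trans (ℕₚ.*-monoʳ-≤ 2 j≤h) (ℕₚ.≤-reflexive (≡.cong (h ℕ.+_) (ℕₚ.+-identityʳ h)))

  Φ2p-in-atoms : Φ N ≋ lincomb B γ (atom K)
  Φ2p-in-atoms i = begin
    Φ N i                      ≈⟨ γ-expansion i ⟩
    atom-sum (φ N) (φ N ℕ./ 2) ≡⟨ ≡.cong (λ n → atom-sum n (n ℕ./ 2)) φ-2p ⟩
    atom-sum K (K ℕ./ 2)       ≡⟨ ≡.cong (atom-sum K) (double/2 h) ⟩
    atom-sum K h               ≈⟨ sum-cong B (λ j _ → *-congˡ (q^j[1+q]^k≋ j _ i)) ⟩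
    lincomb B γ (atom K) i     ∎
    where
    atom-sum : ℕ → ℕ → Carrier
    atom-sum n b = sumUpTo b (λ j → γ j * (powS qS j ⊛ powS (oneS ⊕ qS) (n ∸ 2 ℕ.* j)) i)

  γ-in-atoms-of-p : ∀ i → i < B → lincomb B γ (atom p) i ≈ oneS i
  γ-in-atoms-of-p i i<B = begin
    lincomb B γ (atom p) i                            ≈⟨ lincomb-cong B (λ _ _ → refl) (λ j j<B → atom-suc K j (2j≤K j j<B)) i ⟩
    lincomb B γ (λ j → times[1+q] (atom K j)) i       ≈⟨ sym (IsLinear.lincomb-homo times[1+q]-linear B γ (atom K) i) ⟩
    times[1+q] (lincomb B γ (atom K)) i               ≈⟨ IsLinear.cong times[1+q]-linear (λ k → sym (Φ2p-in-atoms k)) i ⟩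
    times[1+q] (Φ N) i                                ≈⟨ sym (1+q⊛ (Φ N) i) ⟩
    ((oneS ⊕ qS) ⊛ Φ N) i                             ≈⟨ [1+q]Φ2p-below-p i (ℕₚ.<-≤-trans i<B B≤p) ⟩
    oneS i                                            ∎

  γ≈signed-vCoeff : ∀ j → j < B → γ j ≈ pow (- 1#) j * natR (vCoeff p j)
  γ≈signed-vCoeff = coefficients-unique same
    where
    open TriangularUniqueness (atom p) (λ j i i<j → shiftⁿ-below j _ i i<j) (λ i → trans (shiftⁿ-diagonal i _) (+-identityʳ 1#)) B
    same : ∀ i → i < B → lincomb B γ (atom p) i ≈ lincomb B (λ j → pow (- 1#) j * natR (vCoeff p j)) (atom p) i
    same i i<B = begin
      lincomb B γ (atom p) i                                         ≈⟨ γ-in-atoms-of-p i i<B ⟩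
      oneS i                                                         ≈⟨ sym (+-identityʳ _) ⟩
      oneS i + 0#                                                    ≈⟨ +-congˡ (sym (shiftⁿ-below p oneS i (ℕₚ.<-≤-trans i<B B≤p))) ⟩
      oneS i + shiftⁿ p oneS i                                       ≈⟨ sym (signed-atom-expansion p B p<2B i) ⟩
      lincomb B (λ j → pow (- 1#) j * natR (vCoeff p j)) (atom p) i  ∎

  module _ (s t : Carrier) where
    open CompanionLucas R s t using (lucasV; lucasV-expansion; lucasV≈lucas; signs-cancel)

    atom-value : Carrier
    atom-value = sumBelow B (λ j → natR (vCoeff p j) * (pow s (K ∸ 2 ℕ.* j) * pow t j))

    lucasAtom≈atom-value : lucasAtom N γ s t ≈ atom-value
    lucasAtom≈atom-value = begin
      sumUpTo (φ N ℕ./ 2) (term (φ N))  ≡⟨ ≡.cong (λ n → sumUpTo (n ℕ./ 2) (term n)) φ-2p ⟩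
      sumUpTo (K ℕ./ 2) (term K)        ≡⟨ ≡.cong (λ b → sumUpTo b (term K)) (double/2 h) ⟩
      sumBelow B (term K)               ≈⟨ sum-cong B (λ j j<B → trans (*-congʳ (γ≈signed-vCoeff j j<B)) (signs j)) ⟩
      atom-value                        ∎
      where
      term : ℕ → ℕ → Carrier
      term n j = γ j * (pow s (n ∸ 2 ℕ.* j) * pow (- t) j)
      signs : ∀ j → (pow (- 1#) j * natR (vCoeff p j)) * (pow s (K ∸ 2 ℕ.* j) * pow (- t) j)
                    ≈ natR (vCoeff p j) * (pow s (K ∸ 2 ℕ.* j) * pow t j)
      signs j = trans (solve 4 (λ σ d x y → (σ :* d) :* (x :* y) := d :* (x :* (σ :* y))) refl _ _ _ _)
                      (*-congˡ (*-congˡ (signs-cancel j)))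

    rhsSum≈atom-value : rhsSum p s t ≈ atom-value
    rhsSum≈atom-value = begin
      sumUpTo (p ℕ./ 2) term  ≡⟨ ≡.cong (λ b → sumUpTo b term) (suc-double/2 h) ⟩
      sumBelow B term         ≈⟨ sum-cong B (λ k k<B → reflexive (≡.cong₂ (λ a b → natR a * (pow s b * pow t k))
                                   (≡.sym (vCoeff≡binom2 K k (ℕₚ.m≤n⇒m≤1+n (2j≤K k k<B)))) (suc[m]∸n∸1≡m∸n K (2 ℕ.* k)))) ⟩
      atom-value              ∎
      where
      term : ℕ → Carrier
      term k = natR (binom2 p k) * (pow s (p ∸ 2 ℕ.* k ∸ 1) * pow t k)

    s*atom-value≈lucas : s * atom-value ≈ lucas (suc p) s t + t * lucas K s t
    s*atom-value≈lucas = begin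
      s * atom-value  ≈⟨ sum-*ˡ B s _ ⟩
      sumBelow B (λ j → s * (natR (vCoeff p j) * (pow s (K ∸ 2 ℕ.* j) * pow t j)))
        ≈⟨ sum-cong B (λ j j<B → trans (solve 4 (λ s d x y → s :* (d :* (x :* y)) := d :* ((s :* x) :* y)) refl _ _ _ _)
                                       (*-congˡ (*-congʳ (reflexive (≡.cong (pow s) (≡.sym (ℕₚ.+-∸-assoc 1 (2j≤K j j<B)))))))) ⟩
      sumBelow B (λ j → natR (vCoeff p j) * (pow s (p ∸ 2 ℕ.* j) * pow t j))  ≈⟨ lucasV-expansion p B p<2B ⟩
      lucasV p                                                                ≈⟨ lucasV≈lucas K ⟩
      lucas (suc p) s t + t * lucas K s t ∎

    lucasAtom≈rhsSum : lucasAtom N γ s t ≈ rhsSum p s t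
    lucasAtom≈rhsSum = trans lucasAtom≈atom-value (sym rhsSum≈atom-value)

    s*lucasAtom≈lucas : s * lucasAtom N γ s t ≈ lucas (p ℕ.+ 1) s t + t * lucas (p ∸ 1) s t
    s*lucasAtom≈lucas = begin
      s * lucasAtom N γ s t                         ≈⟨ *-congˡ lucasAtom≈atom-value ⟩
      s * atom-value                                ≈⟨ s*atom-value≈lucas ⟩
      lucas (suc p) s t + t * lucas K s t           ≡⟨ ≡.cong (λ n → lucas n s t + t * lucas K s t) (ℕₚ.+-comm 1 p) ⟩
      lucas (p ℕ.+ 1) s t + t * lucas (p ∸ 1) s t   ∎

open import Data.Nat using (_*_; _+_)
open import Data.Nat.Divisibility using (_∣_)
open import Relation.Nullary using (¬_)
open CommutativeRing using (Carrier)
open WithRing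

lemma5p4 : ∀ {c ℓ : Level} (R : CommutativeRing c ℓ) →
    (p : ℕ) → Prime p → ¬ (2 ∣ p) →
    (Φ : ℕ → Ser R) → IsCyclotomic R Φ →
    (γ : ℕ → Carrier R) → IsAtomExpansion R (φ (2 * p)) (Φ (2 * p)) γ →
    (s t : Carrier R) →
    CommutativeRing._≈_ R (lucasAtom R (2 * p) γ s t) (rhsSum R p s t)
    × CommutativeRing._≈_ R
        (CommutativeRing._*_ R s (lucasAtom R (2 * p) γ s t))
        (CommutativeRing._+_ R (lucas R (p + 1) s t)
          (CommutativeRing._*_ R t (lucas R (p ∸ 1) s t)))
lemma5p4 R p p-prime p-odd Φ cyclotomic γ γ-expansion s t with odd-prime-shape p-prime p-odd
... | m , ≡.refl = lucasAtom≈rhsSum s t , s*lucasAtom≈lucas s t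
  where open OddPrimeAtom R m p-prime cyclotomic γ-expansion
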